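{- Let $(f,C)$ be a low-defect pair, and write $\delta(f,C)=\delta(q)+k$ where $q$ is a stable natural number and $k$ is a nonnegative integer. Let $a$ be the leading coefficient of $f$. Then \[\deg f+(C-\deg f-\|a\|_{\mathrm{st}})=k.\] In particular, $\deg f\le k$, and $(f,C)$ is substantial if and only if $\deg f=k$.
   Context: $\|n\|$ denotes the integer complexity of $n\in\mathbb{N}$ (least number of $1$'s needed to write $n$ using $1$, $+$, $\cdot$ and parentheses); $\delta(n)=\|n\|-3\log_3 n$. $n$ is stable if $\|3^kn\|=3k+\|n\|$ for all $k\ge0$; for each $n$ some $3^kn$ is stable, and the stable complexity is $\|n\|_{\mathrm{st}}=\|3^kn\|-3k$ for any such $k$ (well defined). Low-defect pairs: the smallest subset $\mathscr{P}$ of $\mathbb{Z}[x_1,x_2,\ldots]\times\mathbb{N}$ such that (i) $(k,C)\in\mathscr{P}$ for constant $k\in\mathbb{N}$ and $C\ge\|k\|$; (ii) $(f_1,C_1),(f_2,C_2)\in\mathscr{P}$ implies $(f_1\otimes f_2,C_1+C_2)\in\mathscr{P}$, where $f_1\otimes f_2$ is the product of $f_1$ and $f_2$ after relabeling variables so they share none; (iii) $(f,C)\in\mathscr{P}$, $c\in\mathbb{N}$, $D\ge\|c\|$ imply $(f\cdot x+c,C+D)\in\mathscr{P}$ with $x$ a new variable. A low-defect polynomial $f$ is multilinear, its degree equals its number of variables, and the coefficient of the product of all its variables (the leading coefficient) is nonzero. For a pair $(f,C)$ with leading coefficient $a$, $\delta(f,C)=C-3\log_3 a$, and $(f,C)$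 is called substantial if $C=\|a\|_{\mathrm{st}}+\deg f$. -}

module Defs where

open import Data.Nat using (ℕ; zero; suc; _+_; _*_; _^_; _≤_; _⊔_)
open import Data.Bool using (Bool; true; false; if_then_else_)
open import Data.Vec using (Vec; []; _∷_; take; drop; replicate)
open import Data.List using (List; map; _++_; foldr) renaming ([] to []ₗ; _∷_ to _∷ₗ_)
open import Data.Integer using (ℤ; +_) renaming (_*_ to _*ℤ_)
import Data.Integer.Properties as ℤP
open import Data.Product using (Σ; _×_; _,_)
open import Relation.Nullary using (does)
open import Relation.Binary.PropositionalEquality using (_≡_)

data Expr : Set where
  one : Expr
  _⊕_ : Expr → Expr → Expr
  _⊗_ : Expr → Expr → Expr

eval : Expr → ℕ
eval one       = 1
eval (e ⊕ e′)  = eval e + eval e′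
eval (e ⊗ e′)  = eval e * eval e′

ones : Expr → ℕ
ones one       = 1
ones (e ⊕ e′)  = ones e + ones e′
ones (e ⊗ e′)  = ones e + ones e′

Cpx : ℕ → ℕ → Set
Cpx n c = (Σ Expr λ e → eval e ≡ n × ones e ≡ c)
        × (∀ e → eval e ≡ n → c ≤ ones e)

CpxAtMost : ℕ → ℕ → Set
CpxAtMost n C = Σ Expr λ e → eval e ≡ n × ones e ≤ C

Stable : ℕ → Set
Stable n = ∀ k c c′ → Cpx n c → Cpx (3 ^ k * n) c′ → c′ ≡ 3 * k + c

StCpx : ℕ → ℕ → Set
StCpx n s = Σ ℕ λ k → Σ ℕ λ c →
  Stable (3 ^ k * n) × Cpx (3 ^ k * n) c × c ≡ 3 * k + s

-- Multilinear polynomials over ℤ in variables x₀ … x_{n-1}, given by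
-- their coefficient function on monomials ∏_{i ∈ S} xᵢ (S a subset,
-- represented as a Vec Bool n).

Poly : ℕ → Set
Poly n = Vec Bool n → ℤ

allFalse : ∀ {n} → Vec Bool n → Bool
allFalse []          = true
allFalse (true ∷ v)  = false
allFalse (false ∷ v) = allFalse v

constP : ℕ → Poly 0
constP k _ = + k

-- f₁ ⊗ f₂ : product after relabeling so the variables are disjoint
-- (variables of f₁ come first, those of f₂ are shifted after them)
_⊗P_ : ∀ {m n} → Poly m → Poly n → Poly (m + n)
_⊗P_ {m} f g v = f (take m v) *ℤ g (drop m v)

-- f · x + c, with x a new variable (placed in front)
addVar : ∀ {n} → Poly n → ℕ → Poly (suc n)
addVar f c (true ∷ v)  = f v
addVar f c (false ∷ v) = if allFalse v then + c else + 0

data LowDefect : {n : ℕ} → Poly n → ℕ → Set where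
  ld-const : ∀ k C → CpxAtMost k C → LowDefect (constP k) C
  ld-mul   : ∀ {m n} {f : Poly m} {g : Poly n} {C₁ C₂} →
             LowDefect f C₁ → LowDefect g C₂ → LowDefect (f ⊗P g) (C₁ + C₂)
  ld-add   : ∀ {n} {f : Poly n} {C} → LowDefect f C →
             ∀ c D → CpxAtMost c D → LowDefect (addVar f c) (C + D)

subsets : (n : ℕ) → List (Vec Bool n)
subsets zero    = [] ∷ₗ []ₗ
subsets (suc n) = map (false ∷_) (subsets n) ++ map (true ∷_) (subsets n)

weight : ∀ {n} → Vec Bool n → ℕ
weight []          = 0
weight (true ∷ v)  = suc (weight v)
weight (false ∷ v) = weight v

degree : ∀ {n} → Poly n → ℕ
degree {n} f = foldr (λ v d → if does (f v ℤP.≟ + 0) then d else weight v ⊔ d) 0 (subsets n)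

lead : ∀ {n} → Poly n → ℤ
lead {n} f = f (replicate n true)

Substantial : ∀ {n} → Poly n → ℕ → Set
Substantial f C = Σ ℕ λ a → Σ ℕ λ s → lead f ≡ + a × StCpx a s × C ≡ s + degree f

{-# OPTIONS --safe #-}
-- A low-defect pair (f , C) in n variables has degree n, and its leading coefficient a is
-- written with at most C − n ones, so C ≥ ‖a‖_st + deg f.  The defect hypothesis reads
-- 3^C q³ = 3^(‖q‖+k) a³; splitting off the powers of 3 gives 3^v q = 3^u a with
-- C + 3u = ‖q‖ + k + 3v.  Since the stable complexity grows by exactly 3 under
-- multiplication by 3, and ‖q‖_st = ‖q‖ for stable q, this forces C = ‖a‖_st + k; the three
-- claims are then arithmetic.

module Submission where

open import Defs
open import Data.Bool using (Bool; true; false; if_then_else_)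
open import Data.Integer using (ℤ; +_) renaming (_+_ to _+ℤ_; _-_ to _-ℤ_; _*_ to _*ℤ_)
import Data.Integer.Properties as ℤ
open import Data.Integer.Tactic.RingSolver using (solve-∀)
open import Data.List using (List; []; _∷_; _++_; map; foldr; cartesianProductWith)
open import Data.List.Membership.Propositional using (_∈_; lose)
open import Data.List.Membership.Propositional.Properties
  using (∈-++⁺ˡ; ∈-++⁺ʳ; ∈-map⁺; ∈-cartesianProductWith⁺)
open import Data.List.Relation.Unary.Any using (here; there; satisfied; any?)
open import Data.Nat
open import Data.Nat.Divisibility using (_∣_; _∤_; divides; _∣?_; ∣1⇒≡1)
open import Data.Nat.Induction using (<-rec)
open import Data.Nat.Primality using (Prime; euclidsLemma; ¬prime[1]; prime?)
open import Data.Nat.Properties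
open import Data.Nat.Solver using (module +-*-Solver)
open import Data.Product using (Σ; ∃; ∃₂; _×_; _,_)
open import Data.Sum using ([_,_])
open import Data.Vec using (Vec; []; _∷_; take; drop; replicate)
open import Function.Bundles using (_⇔_; mk⇔; Equivalence)
open import Relation.Binary using (tri<; tri≈; tri>)
open import Relation.Binary.PropositionalEquality
  using (_≡_; _≢_; refl; sym; trans; cong; cong₂; subst; module ≡-Reasoning)
open import Relation.Nullary using (yes; no; does; contradiction)
open import Relation.Nullary.Decidable using (map′; _×-dec_; from-yes)
open import Relation.Unary using (Pred; Decidable)

open +-*-Solver using (solve; _:+_; _:*_; _:^_; _:=_; con)

0<ones : ∀ e → 0 < ones e
0<ones one      = z<s
0<ones (e ⊕ e′) = <-≤-trans (0<ones e) (m≤m+n (ones e) (ones e′))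
0<ones (e ⊗ e′) = <-≤-trans (0<ones e) (m≤m+n (ones e) (ones e′))

0<eval : ∀ e → 0 < eval e
0<eval one      = z<s
0<eval (e ⊕ e′) = <-≤-trans (0<eval e) (m≤m+n (eval e) (eval e′))
0<eval (e ⊗ e′) = *-mono-≤ (0<eval e) (0<eval e′)

times3^ : ℕ → Expr → Expr
times3^ zero    e = e
times3^ (suc m) e = (one ⊕ (one ⊕ one)) ⊗ times3^ m e

eval-times3^ : ∀ m e → eval (times3^ m e) ≡ 3 ^ m * eval e
eval-times3^ zero    e = sym (*-identityˡ (eval e))
eval-times3^ (suc m) e = trans (cong (3 *_) (eval-times3^ m e)) (sym (*-assoc 3 (3 ^ m) (eval e)))

ones-times3^ : ∀ m e → ones (times3^ m e) ≡ 3 * m + ones e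
ones-times3^ zero    e = refl
ones-times3^ (suc m) e =
  trans (cong (λ z → 3 + z) (ones-times3^ m e)) (cong (_+ ones e) (sym (*-suc 3 m)))

module _ {p} {P : Pred ℕ p} (P? : Decidable P) where

  HasLeast : Set p
  HasLeast = ∃ λ n → P n × (∀ {n′} → P n′ → n ≤ n′)

  least : ∀ {m} → P m → HasLeast
  least {m} = <-rec (λ m → P m → HasLeast) step m
    where
    step : ∀ m → (∀ {k} → k < m → P k → HasLeast) → P m → HasLeast
    step m rec Pm with anyUpTo? P? m
    ... | yes (k , k<m , Pk) = rec k<m Pk
    ... | no ∄k<m            = m , Pm , λ Pn′ → ≮⇒≥ λ n′<m → ∄k<m (_ , n′<m , Pn′)

Expressible : ℕ → ℕ → Set
Expressible n c = Σ Expr λ e → eval e ≡ n × ones e ≡ c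

exprsUpTo : ℕ → List Expr
exprsUpTo zero    = []
exprsUpTo (suc m) = one ∷ (cartesianProductWith _⊕_ (exprsUpTo m) (exprsUpTo m)
                       ++ cartesianProductWith _⊗_ (exprsUpTo m) (exprsUpTo m))

ones-operands≤ : ∀ {m} e e′ → ones e + ones e′ ≤ suc m → ones e ≤ m × ones e′ ≤ m
ones-operands≤ e e′ le = ≤-pred (<-≤-trans (m<m+n (ones e) (0<ones e′)) le)
                       , ≤-pred (<-≤-trans (m<n+m (ones e′) (0<ones e)) le)

∈-exprsUpTo : ∀ {m} e → ones e ≤ m → e ∈ exprsUpTo m
∈-exprsUpTo {zero}  e        le = contradiction le (<⇒≱ (0<ones e))
∈-exprsUpTo {suc m} one      _  = here refl
∈-exprsUpTo {suc m} (e ⊕ e′) le =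
  let (le₁ , le₂) = ones-operands≤ e e′ le in
  there (∈-++⁺ˡ (∈-cartesianProductWith⁺ _⊕_ (∈-exprsUpTo e le₁) (∈-exprsUpTo e′ le₂)))
∈-exprsUpTo {suc m} (e ⊗ e′) le =
  let (le₁ , le₂) = ones-operands≤ e e′ le in
  there (∈-++⁺ʳ (cartesianProductWith _⊕_ (exprsUpTo m) (exprsUpTo m))
                (∈-cartesianProductWith⁺ _⊗_ (∈-exprsUpTo e le₁) (∈-exprsUpTo e′ le₂)))

expressible? : ∀ n → Decidable (Expressible n)
expressible? n c =
  map′ satisfied (λ (e , e≡n , o≡c) → lose (∈-exprsUpTo e (≤-reflexive o≡c)) (e≡n , o≡c))
       (any? (λ e → eval e ≟ n ×-dec ones e ≟ c) (exprsUpTo c))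

-- Needed because `Stable` only constrains complexities that are known to exist.
cpx-exists : ∀ {n} e → eval e ≡ n → ∃ (Cpx n)
cpx-exists {n} e e≡n =
  let (c , expressible , minimal) = least (expressible? n) (e , e≡n , refl)
  in c , expressible , λ e′ e′≡n → minimal (e′ , e′≡n , refl)

cpx-unique : ∀ {n c c′} → Cpx n c → Cpx n c′ → c ≡ c′
cpx-unique ((e , e≡n , refl) , minimal) ((e′ , e′≡n , refl) , minimal′) =
  ≤-antisym (minimal e′ e′≡n) (minimal′ e e≡n)

stable⇒cpx-3^* : ∀ {y c} → Stable y → Cpx y c → ∀ m → Cpx (3 ^ m * y) (3 * m + c)
stable⇒cpx-3^* {c = c} y-stable y-cpx@((e , refl , _) , _) m =
  let (c′ , cpx′) = cpx-exists (times3^ m e) (eval-times3^ m e)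
  in subst (Cpx (3 ^ m * eval e)) (y-stable m c c′ y-cpx cpx′) cpx′

stable⇒stCpx : ∀ {q c} → Stable q → Cpx q c → StCpx q c
stable⇒stCpx {q} {c} q-stable q-cpx =
  0 , c , subst Stable q≡1*q q-stable , subst (λ z → Cpx z c) q≡1*q q-cpx , refl
  where
  q≡1*q : q ≡ 3 ^ 0 * q
  q≡1*q = sym (*-identityˡ q)

stCpx⇒0< : ∀ {x s} → StCpx x s → 0 < x
stCpx⇒0< {zero}  (k , _ , _ , ((e , e≡0 , _) , _) , _) =
  contradiction (trans e≡0 (*-zeroʳ (3 ^ k))) (>⇒≢ (0<eval e))
stCpx⇒0< {suc x} _ = z<s

-- Both sides are complexities of the common multiple 3^(k+l+i) x of the stable numbers
-- 3^k x and 3^l y.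
stCpx-3^* : ∀ {x s y t i j} → StCpx x s → StCpx y t →
            3 ^ i * x ≡ 3 ^ j * y → 3 * i + s ≡ 3 * j + t
stCpx-3^* {x} {s} {y} {t} {i} {j}
          (k , _ , x-stable , x-cpx , refl) (l , _ , y-stable , y-cpx , refl) eq =
  +-cancelˡ-≡ (3 * (k + l)) (3 * i + s) (3 * j + t) (begin
    3 * (k + l) + (3 * i + s)
      ≡⟨ solve 4 (λ k l i s → con 3 :* (k :+ l) :+ (con 3 :* i :+ s)
                             := con 3 :* (l :+ i) :+ (con 3 :* k :+ s)) refl k l i s ⟩
    3 * (l + i) + (3 * k + s)
      ≡⟨ cpx-unique (stable⇒cpx-3^* x-stable x-cpx (l + i))
                    (subst (λ z → Cpx z (3 * (k + j) + (3 * l + t))) same-multiple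
                           (stable⇒cpx-3^* y-stable y-cpx (k + j))) ⟩
    3 * (k + j) + (3 * l + t)
      ≡⟨ solve 4 (λ k l j t → con 3 :* (k :+ j) :+ (con 3 :* l :+ t)
                             := con 3 :* (k :+ l) :+ (con 3 :* j :+ t)) refl k l j t ⟩
    3 * (k + l) + (3 * j + t) ∎)
  where
  open ≡-Reasoning
  same-multiple : 3 ^ (k + j) * (3 ^ l * y) ≡ 3 ^ (l + i) * (3 ^ k * x)
  same-multiple = begin
    3 ^ (k + j) * (3 ^ l * y)    ≡⟨ cong (_* (3 ^ l * y)) (^-distribˡ-+-* 3 k j) ⟩
    3 ^ k * 3 ^ j * (3 ^ l * y)  ≡⟨ solve 4 (λ K J L y → K :* J :* (L :* y) := K :* L :* (J :* y))
                                      refl (3 ^ k) (3 ^ j) (3 ^ l) y ⟩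
    3 ^ k * 3 ^ l * (3 ^ j * y)  ≡⟨ cong (3 ^ k * 3 ^ l *_) (sym eq) ⟩
    3 ^ k * 3 ^ l * (3 ^ i * x)  ≡⟨ solve 4 (λ K L I x → K :* L :* (I :* x) := L :* I :* (K :* x))
                                      refl (3 ^ k) (3 ^ l) (3 ^ i) x ⟩
    3 ^ l * 3 ^ i * (3 ^ k * x)  ≡⟨ cong (_* (3 ^ k * x)) (sym (^-distribˡ-+-* 3 l i)) ⟩
    3 ^ (l + i) * (3 ^ k * x)    ∎

stCpx-unique : ∀ {x s s′} → StCpx x s → StCpx x s′ → s ≡ s′
stCpx-unique x-st x-st′ = stCpx-3^* {i = 0} {j = 0} x-st x-st′ refl

stCpx≤ones : ∀ {a s} → StCpx a s → ∀ e → eval e ≡ a → s ≤ ones e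
stCpx≤ones {a} {s} (k , _ , _ , (_ , minimal) , refl) e e≡a =
  +-cancelˡ-≤ (3 * k) s (ones e)
    (subst (3 * k + s ≤_) (ones-times3^ k e)
      (minimal (times3^ k e) (trans (eval-times3^ k e) (cong (3 ^ k *_) e≡a))))

∤⇒∤^ : ∀ {p x} → Prime p → p ∤ x → ∀ n → p ∤ x ^ n
∤⇒∤^ p-prime p∤x zero    p∣1  = ¬prime[1] (subst Prime (∣1⇒≡1 p∣1) p-prime)
∤⇒∤^ {x = x} p-prime p∤x (suc n) p∣x^1+n =
  [ p∤x , ∤⇒∤^ p-prime p∤x n ] (euclidsLemma x (x ^ n) p-prime p∣x^1+n)

^-cancelʳ-≡ : ∀ {x y} n .{{_ : NonZero n}} → x ^ n ≡ y ^ n → x ≡ y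
^-cancelʳ-≡ {x} {y} n eq with <-cmp x y
... | tri< x<y _ _ = contradiction eq (<⇒≢ (^-monoˡ-< n x<y))
... | tri≈ _ x≡y _ = x≡y
... | tri> _ _ y<x = contradiction eq (>⇒≢ (^-monoˡ-< n y<x))

PowerSplit : ℕ → ℕ → Set
PowerSplit p x = ∃₂ λ u w → p ∤ w × x ≡ p ^ u * w

powerSplit : ∀ {p} → 1 < p → ∀ x → 0 < x → PowerSplit p x
powerSplit {p} 1<p = <-rec (λ x → 0 < x → PowerSplit p x) step
  where
  step : ∀ x → (∀ {y} → y < x → 0 < y → PowerSplit p y) → 0 < x → PowerSplit p x
  step x rec 0<x with p ∣? x
  ... | no p∤x                      = 0 , x , p∤x , sym (*-identityˡ x)
  ... | yes (divides zero refl)     = contradiction 0<x (<-irrefl refl)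
  ... | yes (divides y@(suc _) refl) =
    let (u , w , p∤w , y≡p^u*w) = rec (m<m*n y p 1<p) z<s
    in suc u , w , p∤w , (begin
      y * p             ≡⟨ *-comm y p ⟩
      p * y             ≡⟨ cong (p *_) y≡p^u*w ⟩
      p * (p ^ u * w)   ≡⟨ sym (*-assoc p (p ^ u) w) ⟩
      p ^ suc u * w     ∎)
    where open ≡-Reasoning

p^-<⇒∣ : ∀ {p u v m n} .{{_ : NonZero p}} → p ^ u * m ≡ p ^ v * n → u < v → p ∣ m
p^-<⇒∣ {p} {u} {v} {m} {n} eq u<v =
  divides (p ^ d * n) (*-cancelˡ-≡ m (p ^ d * n * p) (p ^ u) {{m^n≢0 p u}} (begin
    p ^ u * m                ≡⟨ eq ⟩
    p ^ v * n                ≡⟨ cong (λ i → p ^ i * n) (sym u+[1+d]≡v) ⟩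
    p ^ (u + suc d) * n      ≡⟨ cong (_* n) (^-distribˡ-+-* p u (suc d)) ⟩
    p ^ u * (p * p ^ d) * n  ≡⟨ solve 4 (λ U p D n → U :* (p :* D) :* n := U :* (D :* n :* p))
                                  refl (p ^ u) p (p ^ d) n ⟩
    p ^ u * (p ^ d * n * p)  ∎))
  where
  open ≡-Reasoning
  d : ℕ
  d = v ∸ suc u
  u+[1+d]≡v : u + suc d ≡ v
  u+[1+d]≡v = trans (+-suc u d) (m+[n∸m]≡n u<v)

powerSplit-unique : ∀ {p u v m n} .{{_ : NonZero p}} → p ∤ m → p ∤ n →
                    p ^ u * m ≡ p ^ v * n → u ≡ v × m ≡ n
powerSplit-unique {p} {u} {v} {m} {n} p∤m p∤n eq with <-cmp u v
... | tri< u<v _ _  = contradiction (p^-<⇒∣ eq u<v) p∤m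
... | tri> _ _ v<u  = contradiction (p^-<⇒∣ (sym eq) v<u) p∤n
... | tri≈ _ refl _ = refl , *-cancelˡ-≡ m n (p ^ u) {{m^n≢0 p u}} eq

p^a*[p^u*w]³ : ∀ p a u w → p ^ a * (p ^ u * w) ^ 3 ≡ p ^ (a + u * 3) * w ^ 3
p^a*[p^u*w]³ p a u w = begin
  p ^ a * (p ^ u * w) ^ 3      ≡⟨ solve 3 (λ A U w → A :* (U :* w) :^ 3 := A :* U :^ 3 :* w :^ 3)
                                     refl (p ^ a) (p ^ u) w ⟩
  p ^ a * (p ^ u) ^ 3 * w ^ 3  ≡⟨ cong (λ z → p ^ a * z * w ^ 3) (^-*-assoc p u 3) ⟩
  p ^ a * p ^ (u * 3) * w ^ 3  ≡⟨ cong (_* w ^ 3) (sym (^-distribˡ-+-* p a (u * 3))) ⟩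
  p ^ (a + u * 3) * w ^ 3      ∎
  where open ≡-Reasoning

prime[3] : Prime 3
prime[3] = from-yes (prime? 3)

-- 3^A x³ = 3^B y³ says A + 3 log₃ x = B + 3 log₃ y, so the conclusion says that x and y
-- have the same stable defect.
stCpx-balance : ∀ {x s y t A B} → StCpx x s → StCpx y t →
                3 ^ A * x ^ 3 ≡ 3 ^ B * y ^ 3 → A + s ≡ B + t
stCpx-balance {x} {s} {y} {t} {A} {B} x-st y-st eq
  with powerSplit {3} (s≤s (s≤s z≤n)) x (stCpx⇒0< x-st)
     | powerSplit {3} (s≤s (s≤s z≤n)) y (stCpx⇒0< y-st)
... | u , w , 3∤w , refl | v , w′ , 3∤w′ , refl
  with powerSplit-unique {u = A + u * 3} {B + v * 3}
         (∤⇒∤^ prime[3] 3∤w 3) (∤⇒∤^ prime[3] 3∤w′ 3)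
         (trans (sym (p^a*[p^u*w]³ 3 A u w)) (trans eq (p^a*[p^u*w]³ 3 B v w′)))
... | A+3u≡B+3v , w³≡w′³ with ^-cancelʳ-≡ {w} {w′} 3 w³≡w′³
... | refl = +-cancelʳ-≡ (3 * u + 3 * v) (A + s) (B + t) (begin
  A + s + (3 * u + 3 * v)  ≡⟨ solve 4 (λ A s u v → A :+ s :+ (con 3 :* u :+ con 3 :* v)
                                        := A :+ u :* con 3 :+ (con 3 :* v :+ s)) refl A s u v ⟩
  A + u * 3 + (3 * v + s)  ≡⟨ cong₂ _+_ A+3u≡B+3v
                                (stCpx-3^* {i = v} {j = u} x-st y-st 3^v*x≡3^u*y) ⟩
  B + v * 3 + (3 * u + t)  ≡⟨ solve 4 (λ B t u v → B :+ v :* con 3 :+ (con 3 :* u :+ t)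
                                        := B :+ t :+ (con 3 :* u :+ con 3 :* v)) refl B t u v ⟩
  B + t + (3 * u + 3 * v)  ∎)
  where
  open ≡-Reasoning
  3^v*x≡3^u*y : 3 ^ v * (3 ^ u * w) ≡ 3 ^ u * (3 ^ v * w)
  3^v*x≡3^u*y = solve 3 (λ V U w → V :* (U :* w) := U :* (V :* w)) refl (3 ^ v) (3 ^ u) w

weight≤ : ∀ {n} (v : Vec Bool n) → weight v ≤ n
weight≤ []          = z≤n
weight≤ (true ∷ v)  = s≤s (weight≤ v)
weight≤ (false ∷ v) = m≤n⇒m≤1+n (weight≤ v)

weight-replicate : ∀ n → weight (replicate n true) ≡ n
weight-replicate zero    = refl
weight-replicate (suc n) = cong suc (weight-replicate n)

replicate∈subsets : ∀ n → replicate n true ∈ subsets n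
replicate∈subsets zero    = here refl
replicate∈subsets (suc n) =
  ∈-++⁺ʳ (map (false ∷_) (subsets n)) (∈-map⁺ (true ∷_) (replicate∈subsets n))

module _ {n} (f : Poly n) where

  -- definitionally the step of the fold defining `degree`
  private
    step : Vec Bool n → ℕ → ℕ
    step v d = if does (f v ℤ.≟ + 0) then d else weight v ⊔ d

  foldr-step≤ : ∀ vs → foldr step 0 vs ≤ n
  foldr-step≤ []       = z≤n
  foldr-step≤ (v ∷ vs) with f v ℤ.≟ + 0
  ... | yes _ = foldr-step≤ vs
  ... | no _  = ⊔-lub (weight≤ v) (foldr-step≤ vs)

  weight≤foldr-step : ∀ {v} vs → v ∈ vs → f v ≢ + 0 → weight v ≤ foldr step 0 vs
  weight≤foldr-step {v} (_ ∷ vs) (here refl) fv≢0 with f v ℤ.≟ + 0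
  ... | yes fv≡0 = contradiction fv≡0 fv≢0
  ... | no _     = m≤m⊔n (weight v) (foldr step 0 vs)
  weight≤foldr-step (w ∷ vs) (there v∈vs) fv≢0 with f w ℤ.≟ + 0
  ... | yes _ = weight≤foldr-step vs v∈vs fv≢0
  ... | no _  = ≤-trans (weight≤foldr-step vs v∈vs fv≢0) (m≤n⊔m (weight w) (foldr step 0 vs))

  lead≢0⇒degree≡n : lead f ≢ + 0 → degree f ≡ n
  lead≢0⇒degree≡n lead≢0 = ≤-antisym (foldr-step≤ (subsets n))
    (subst (_≤ degree f) (weight-replicate n)
      (weight≤foldr-step (subsets n) (replicate∈subsets n) lead≢0))

take-replicate : ∀ {A : Set} m {n} (x : A) → take m (replicate (m + n) x) ≡ replicate m x
take-replicate zero    x = refl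
take-replicate (suc m) x = cong (x ∷_) (take-replicate m x)

drop-replicate : ∀ {A : Set} m {n} (x : A) → drop m (replicate (m + n) x) ≡ replicate n x
drop-replicate zero    x = refl
drop-replicate (suc m) x = drop-replicate m x

lead-⊗P : ∀ {m n} (f : Poly m) (g : Poly n) → lead (f ⊗P g) ≡ lead f *ℤ lead g
lead-⊗P {m} f g = cong₂ (λ u v → f u *ℤ g v) (take-replicate m true) (drop-replicate m true)

-- Each variable is paid for by the complexity of a constant c, which is at least 1.
lowDefect-lead : ∀ {n} {f : Poly n} {C} → LowDefect f C →
                 Σ Expr λ e → lead f ≡ + eval e × n + ones e ≤ C
lowDefect-lead (ld-const k C (e , e≡k , ones≤C)) = e , cong +_ (sym e≡k) , ones≤C
lowDefect-lead (ld-mul {m} {n} {f} {g} f-ld g-ld) with lowDefect-lead f-ld | lowDefect-lead g-ld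
... | e , lead-f , bound | e′ , lead-g , bound′ =
  e ⊗ e′ , lead≡ , ≤-trans (≤-reflexive regroup) (+-mono-≤ bound bound′)
  where
  open ≡-Reasoning
  lead≡ : lead (f ⊗P g) ≡ + (eval e * eval e′)
  lead≡ = begin
    lead (f ⊗P g)              ≡⟨ lead-⊗P f g ⟩
    lead f *ℤ lead g           ≡⟨ cong₂ _*ℤ_ lead-f lead-g ⟩
    + eval e *ℤ + eval e′      ≡⟨ sym (ℤ.pos-* (eval e) (eval e′)) ⟩
    + (eval e * eval e′)       ∎
  regroup : m + n + (ones e + ones e′) ≡ m + ones e + (n + ones e′)
  regroup = solve 4 (λ m n o o′ → m :+ n :+ (o :+ o′) := m :+ o :+ (n :+ o′))
                    refl m n (ones e) (ones e′)
lowDefect-lead (ld-add {n} {C = C} f-ld c D (e′ , _ , ones≤D)) with lowDefect-lead f-ld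
... | e , lead-f , bound =
  e , lead-f , subst (suc (n + ones e) ≤_) (+-comm D C)
                     (+-mono-≤ (≤-trans (0<ones e′) ones≤D) bound)

lowDefect-degree : ∀ {n} {f : Poly n} {C} → LowDefect f C → degree f ≡ n
lowDefect-degree {f = f} f-ld =
  let (e , lead≡e , _) = lowDefect-lead f-ld
  in lead≢0⇒degree≡n f λ lead≡0 → >⇒≢ (0<eval e) (ℤ.+-injective (trans (sym lead≡e) lead≡0))

lowDefect-stCpx+degree≤ : ∀ {n} {f : Poly n} {C a s} →
                          LowDefect f C → lead f ≡ + a → StCpx a s → s + degree f ≤ C
lowDefect-stCpx+degree≤ {n} {f} {C} {a} {s} f-ld lead≡a a-st =
  let (e , lead≡e , bound) = lowDefect-lead f-ld
      s≤ones = stCpx≤ones a-st e (ℤ.+-injective (trans (sym lead≡e) lead≡a))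
  in begin
    s + degree f  ≡⟨ cong (λ z → s + z) (lowDefect-degree f-ld) ⟩
    s + n         ≤⟨ +-monoˡ-≤ n s≤ones ⟩
    ones e + n    ≡⟨ +-comm (ones e) n ⟩
    n + ones e    ≤⟨ bound ⟩
    C             ∎
  where open ≤-Reasoning

substantial⇔ : ∀ {n} {f : Poly n} {C a s} → lead f ≡ + a → StCpx a s →
               Substantial f C ⇔ C ≡ s + degree f
substantial⇔ {f = f} {C} {a} {s} lead≡a a-st = mk⇔ to (λ C≡ → a , s , lead≡a , a-st , C≡)
  where
  to : Substantial f C → C ≡ s + degree f
  to (a′ , s′ , lead≡a′ , a′-st , C≡) with ℤ.+-injective (trans (sym lead≡a′) lead≡a)
  ... | refl = trans C≡ (cong (_+ degree f) (stCpx-unique a′-st a-st))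

ℤ-excess-identity : ∀ (d s k : ℤ) → d +ℤ ((s +ℤ k -ℤ d) -ℤ s) ≡ k
ℤ-excess-identity = solve-∀

proposition3p3 : ∀ {n} (f : Poly n) (C : ℕ) → LowDefect f C →
    ∀ (a : ℕ) → lead f ≡ + a →
    ∀ (q k cq : ℕ) → Stable q → Cpx q cq →
    3 ^ C * q ^ 3 ≡ 3 ^ (cq + k) * a ^ 3 →
    ∀ (s : ℕ) → StCpx a s →
    (+ degree f +ℤ ((+ C -ℤ + degree f) -ℤ + s) ≡ + k)
    × degree f ≤ k
    × (Substantial f C ⇔ degree f ≡ k)
proposition3p3 f C f-ld a lead≡a q k cq q-stable q-cpx defects s a-st =
  excess≡k , degree≤k , mk⇔ (λ sub → +-cancelˡ-≡ s (degree f) k (trans (sym (to sub)) C≡s+k))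
                            (λ degree≡k → from (trans C≡s+k (cong (λ z → s + z) (sym degree≡k))))
  where
  open Equivalence (substantial⇔ {f = f} {C} lead≡a a-st)
  C≡s+k : C ≡ s + k
  C≡s+k = +-cancelʳ-≡ cq C (s + k)
    (trans (stCpx-balance (stable⇒stCpx q-stable q-cpx) a-st defects)
           (solve 3 (λ cq k s → cq :+ k :+ s := s :+ k :+ cq) refl cq k s))
  excess≡k : + degree f +ℤ ((+ C -ℤ + degree f) -ℤ + s) ≡ + k
  excess≡k rewrite C≡s+k | ℤ.pos-+ s k = ℤ-excess-identity (+ degree f) (+ s) (+ k)
  degree≤k : degree f ≤ k
  degree≤k = +-cancelˡ-≤ s (degree f) k
    (subst (s + degree f ≤_) C≡s+k (lowDefect-stCpx+degree≤ f-ld lead≡a a-st))
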